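{- Let $G$ be a graph with no $K_{1,1,3}$ minor and let $S$ be a spanning subgraph of $G$ that is a subdivision of $K_{2,3}$. Then every terminal path of $S$ is chordless in $G$.
   Context: A subdivision of a graph is obtained by repeatedly replacing an edge $(x,y)$ by a path $x,w,y$ through a new vertex $w$. $S$ is spanning if every vertex of $G$ is a vertex of $S$. For a subdivision $S$ of $K_{2,3}$, the terminal vertices are the two vertices $u,v$ of degree $3$ in $S$, and the terminal paths are the three $uv$-paths in $S$. A path $P$ in $G$ is chordless if $G$ has no edge joining two non-consecutive vertices of $P$. -}

module Defs where

open import Data.Nat using (ℕ; zero; suc; _+_; _≤_)
open import Data.Fin using (Fin; zero; suc; toℕ; inject₁)
open import Data.Bool using (Bool; true; false; T)
open import Data.Maybe using (Maybe; just; nothing)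
open import Data.Product using (Σ; ∃; ∃-syntax; _×_; _,_)
open import Data.Sum using (_⊎_)
open import Data.Empty using (⊥)
open import Relation.Nullary using (¬_; Dec)
open import Relation.Binary.PropositionalEquality using (_≡_; _≢_)
open import Function.Definitions using (Injective)

record Graph : Set₁ where
  field
    n      : ℕ
    E      : Fin n → Fin n → Set
    E-dec  : ∀ x y → Dec (E x y)
    E-sym  : ∀ {x y} → E x y → E y x
    E-irr  : ∀ {x} → ¬ E x x

open Graph public

Vtx : Graph → Set
Vtx G = Fin (n G)

-- A model of H in G assigns to some vertices
-- x of G a vertex β x = just h of H (so branch sets are pairwise
-- disjoint); each branch set is nonempty and connected in G, and for
-- each edge hh' of H there is an edge of G between the branch sets.

data WalkIn (G : Graph) (P : Vtx G → Set) : Vtx G → Vtx G → Set where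
  here : ∀ {x} → P x → WalkIn G P x x
  step : ∀ {x y z} → P x → E G x y → WalkIn G P y z → WalkIn G P x z

record MinorModel (H G : Graph) : Set where
  field
    β         : Vtx G → Maybe (Vtx H)
    nonempty  : ∀ h → ∃[ x ] (β x ≡ just h)
    connected : ∀ h x y → β x ≡ just h → β y ≡ just h →
                WalkIn G (λ z → β z ≡ just h) x y
    edges     : ∀ h h' → E H h h' →
                ∃[ x ] ∃[ y ] (β x ≡ just h × β y ≡ just h' × E G x y)

HasMinor : Graph → Graph → Set
HasMinor G H = MinorModel H G

-- K_{1,1,3}: vertices 0,1 adjacent to everything, 2,3,4 independent.

k113-adj : Fin 5 → Fin 5 → Bool
k113-adj zero zero = false
k113-adj zero (suc _) = true
k113-adj (suc zero) zero = true
k113-adj (suc zero) (suc zero) = false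
k113-adj (suc zero) (suc (suc _)) = true
k113-adj (suc (suc _)) zero = true
k113-adj (suc (suc _)) (suc zero) = true
k113-adj (suc (suc _)) (suc (suc _)) = false

private
  T-dec : ∀ b → Dec (T b)
  T-dec true  = Relation.Nullary.yes _
  T-dec false = Relation.Nullary.no (λ ())

  k-sym : ∀ {x y} → T (k113-adj x y) → T (k113-adj y x)
  k-sym {zero} {suc zero} t = t
  k-sym {zero} {suc (suc y)} t = t
  k-sym {suc zero} {zero} t = t
  k-sym {suc zero} {suc (suc y)} t = t
  k-sym {suc (suc x)} {zero} t = t
  k-sym {suc (suc x)} {suc zero} t = t

  k-irr : ∀ {x} → ¬ T (k113-adj x x)
  k-irr {zero} ()
  k-irr {suc zero} ()
  k-irr {suc (suc x)} ()

K113 : Graph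
K113 = record
  { n = 5 ; E = λ x y → T (k113-adj x y) ; E-dec = λ x y → T-dec (k113-adj x y)
  ; E-sym = k-sym ; E-irr = k-irr }

record Path (G : Graph) (a b : Vtx G) : Set where
  field
    len   : ℕ
    vert  : Fin (suc len) → Vtx G
    inj   : Injective _≡_ _≡_ vert
    start : vert zero ≡ a
    end   : vert (Data.Fin.fromℕ len) ≡ b
    adj   : ∀ (i : Fin len) → E G (vert (inject₁ i)) (vert (suc i))

open Path public

Chordless : ∀ {G a b} → Path G a b → Set
Chordless {G} P = ∀ (i j : Fin (suc (len P))) → 2 + toℕ i ≤ toℕ j →
                  ¬ E G (vert P i) (vert P j)

-- A subgraph S of G that is a subdivision of K_{2,3}: terminal vertices
-- u ≠ v and three internally disjoint uv-paths (the terminal paths),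
-- each with at least one internal vertex (the subdivided vertices of
-- degree 2 of K_{2,3}).  S is the union of these paths.

record K23Subdivision (G : Graph) : Set where
  field
    u v       : Vtx G
    u≢v       : u ≢ v
    path      : Fin 3 → Path G u v
    long      : ∀ k → 2 ≤ len (path k)
    disjoint  : ∀ k l → k ≢ l → ∀ i j →
                vert (path k) i ≡ vert (path l) j →
                (vert (path k) i ≡ u) ⊎ (vert (path k) i ≡ v)

open K23Subdivision public

Spanning : ∀ {G} → K23Subdivision G → Set
Spanning {G} S = ∀ (x : Vtx G) → ∃[ k ] ∃[ i ] (vert (path S k) i ≡ x)

-- Suppose a terminal path P of S has a chord joining its vertices at
-- positions I and J ≥ I + 2.  Cut P into the segment from u up to
-- position I, the segment from position J up to v, and the open
-- segment between them, and take the interiors of the two other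
-- terminal paths.  These five connected sets are pairwise disjoint; the
-- first two are adjacent to each other (by the chord), to the middle
-- segment (along P), and to both interiors (via u and v), so they are
-- the branch sets of a K_{1,1,3} minor.
module Submission where

open import Defs
open import Data.Fin using (Fin; zero; suc; toℕ; fromℕ; fromℕ<; inject₁)
open import Data.Fin.Properties using (any?; toℕ<n; toℕ-fromℕ<; fromℕ<-toℕ; toℕ-inject₁; toℕ-fromℕ)
  renaming (_≟_ to _≟ᶠ_)
open import Data.Nat using (ℕ; zero; suc; _≤_; _<_; z≤n; s≤s; _≤?_; _<?_)
open import Data.Nat.Properties using (≤-refl; ≤-trans; ≤-total; ≤-pred; ≤-reflexive; <⇒≤; <-irrefl;
  <-≤-trans; n≤1+n; m≤n⇒m<n∨m≡n)
open import Data.Maybe using (Maybe; just; nothing)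
open import Data.Product using (∃; ∃₂; _×_; _,_)
open import Data.Sum using (inj₁; inj₂)
open import Data.Empty using (⊥; ⊥-elim)
open import Relation.Nullary using (¬_; Dec; yes; no)
open import Relation.Nullary.Decidable using (map′; _×-dec_)
open import Relation.Binary.PropositionalEquality using (_≡_; _≢_; ≢-sym; refl; sym; trans; cong; subst; subst₂)

module _ {G : Graph} {P Q : Vtx G → Set} where

  WalkIn-map : (∀ {z} → P z → Q z) → ∀ {x y} → WalkIn G P x y → WalkIn G Q x y
  WalkIn-map f (here p)     = here (f p)
  WalkIn-map f (step p e w) = step (f p) e (WalkIn-map f w)

module _ {G : Graph} {P : Vtx G → Set} where

  WalkIn-snoc : ∀ {x y z} → WalkIn G P x y → P z → E G y z → WalkIn G P x z
  WalkIn-snoc (here p)      pz e′ = step p e′ (here pz)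
  WalkIn-snoc (step p e w) pz e′ = step p e (WalkIn-snoc w pz e′)

  WalkIn-reverse : ∀ {x y} → WalkIn G P x y → WalkIn G P y x
  WalkIn-reverse (here p)     = here p
  WalkIn-reverse (step p e w) = WalkIn-snoc (WalkIn-reverse w) p (E-sym G e)

record Adjacent (G : Graph) (A B : Vtx G → Set) : Set where
  constructor adjacent
  field
    {x y} : Vtx G
    x∈A   : A x
    y∈B   : B y
    edge  : E G x y

Adjacent-sym : ∀ {G A B} → Adjacent G A B → Adjacent G B A
Adjacent-sym {G} (adjacent x∈A y∈B e) = adjacent y∈B x∈A (E-sym G e)

record BranchSets (H G : Graph) : Set₁ where
  field
    Branch            : Vtx H → Vtx G → Set
    branch?           : ∀ h x → Dec (Branch h x)
    branches-disjoint : ∀ {h h′ x} → Branch h x → Branch h′ x → h ≡ h′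
    branch-nonempty   : ∀ h → ∃ (Branch h)
    branch-connected  : ∀ h {x y} → Branch h x → Branch h y → WalkIn G (Branch h) x y
    branches-adjacent : ∀ h h′ → E H h h′ → Adjacent G (Branch h) (Branch h′)

branchSets⇒minor : ∀ {H G} → BranchSets H G → HasMinor G H
branchSets⇒minor {H} {G} B = record
  { β         = β
  ; nonempty  = λ h → let x , b = branch-nonempty h in x , β-complete b
  ; connected = λ h x y βx βy →
      WalkIn-map β-complete (branch-connected h (β-sound βx) (β-sound βy))
  ; edges     = λ h h′ e → let adjacent x∈ y∈ exy = branches-adjacent h h′ e
                           in _ , _ , β-complete x∈ , β-complete y∈ , exy
  }
  where
    open BranchSets B

    β : Vtx G → Maybe (Vtx H)
    β x with any? (λ h → branch? h x)
    ... | yes (h , _) = just h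
    ... | no _        = nothing

    β-sound : ∀ {h x} → β x ≡ just h → Branch h x
    β-sound {x = x} with any? (λ h → branch? h x)
    ... | yes (_ , b) = λ { refl → b }
    ... | no _        = λ ()

    β-complete : ∀ {h x} → Branch h x → β x ≡ just h
    β-complete {x = x} b with any? (λ h → branch? h x)
    ... | yes (_ , b′) = cong just (branches-disjoint b′ b)
    ... | no ¬b        = ⊥-elim (¬b (_ , b))

two≤⇒penultimate : ∀ {n} → 2 ≤ n → ∃ λ t → suc t ≡ n × 1 ≤ t
two≤⇒penultimate (s≤s (s≤s {n = t} _)) = suc t , refl , s≤s z≤n

module _ {G : Graph} {a b : Vtx G} (P : Path G a b) where

  private
    L : ℕ
    L = len P

  -- Positions beyond the end of P are clamped to its last vertex.
  at : ℕ → Vtx G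
  at t with t <? suc L
  ... | yes t<1+L = vert P (fromℕ< t<1+L)
  ... | no _      = b

  at-index : ∀ {t} (i : Fin (suc L)) → toℕ i ≡ t → at t ≡ vert P i
  at-index i refl with toℕ i <? suc L
  ... | yes i<1+L = cong (vert P) (fromℕ<-toℕ i i<1+L)
  ... | no i≮1+L  = ⊥-elim (i≮1+L (toℕ<n i))

  at-on-path : ∀ t → ∃ λ i → at t ≡ vert P i
  at-on-path t with t <? suc L
  ... | yes t<1+L = fromℕ< t<1+L , refl
  ... | no _      = fromℕ L , sym (end P)

  at-zero : at 0 ≡ a
  at-zero = trans (at-index zero refl) (start P)

  at-len : at L ≡ b
  at-len = trans (at-index (fromℕ L) (toℕ-fromℕ L)) (end P)

  at-injective : ∀ {s t} → s ≤ L → t ≤ L → at s ≡ at t → s ≡ t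
  at-injective s≤L t≤L eq =
    trans (sym (toℕ-fromℕ< _)) (trans (cong toℕ i≡j) (toℕ-fromℕ< _))
    where
      i = fromℕ< (s≤s s≤L)
      j = fromℕ< (s≤s t≤L)
      i≡j : i ≡ j
      i≡j = inj P (trans (sym (at-index i (toℕ-fromℕ< _)))
                        (trans eq (at-index j (toℕ-fromℕ< _))))

  at-adjacent : ∀ {t} → t < L → E G (at t) (at (suc t))
  at-adjacent t<L = subst₂ (E G)
    (sym (at-index (inject₁ i) (trans (toℕ-inject₁ i) (toℕ-fromℕ< t<L))))
    (sym (at-index (suc i) (cong suc (toℕ-fromℕ< t<L))))
    (adj P i)
    where i = fromℕ< t<L

  InSegment : ℕ → ℕ → Vtx G → Set
  InSegment lo hi x = ∃ λ t → lo ≤ t × t < hi × at t ≡ x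

  Interior : Vtx G → Set
  Interior = InSegment 1 L

  inSegment? : ∀ lo hi x → Dec (InSegment lo hi x)
  inSegment? lo hi x = map′
    (λ (i , lo≤i , eq) → toℕ i , lo≤i , toℕ<n i , eq)
    (λ (t , lo≤t , t<hi , eq) → fromℕ< t<hi ,
       subst (λ s → lo ≤ s × at s ≡ x) (sym (toℕ-fromℕ< t<hi)) (lo≤t , eq))
    (any? λ (i : Fin hi) → (lo ≤? toℕ i) ×-dec (at (toℕ i) ≟ᶠ x))

  segment-walk-up : ∀ {lo hi s t} → hi ≤ suc L → lo ≤ s → s ≤ t → t < hi →
                    WalkIn G (InSegment lo hi) (at s) (at t)
  segment-walk-up {t = zero} _ lo≤s z≤n t<hi = here (0 , lo≤s , t<hi , refl)
  segment-walk-up {s = s} {suc t} hi≤ lo≤s s≤t t<hi with m≤n⇒m<n∨m≡n s≤t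
  ... | inj₂ refl = here (s , lo≤s , t<hi , refl)
  ... | inj₁ (s≤s s≤t′) =
    WalkIn-snoc (segment-walk-up hi≤ lo≤s s≤t′ (<⇒≤ t<hi))
                (suc t , ≤-trans lo≤s s≤t , t<hi , refl)
                (at-adjacent (≤-pred (≤-trans t<hi hi≤)))

  segment-connected : ∀ {lo hi x y} → hi ≤ suc L →
                      InSegment lo hi x → InSegment lo hi y → WalkIn G (InSegment lo hi) x y
  segment-connected hi≤ (s , lo≤s , s<hi , refl) (t , lo≤t , t<hi , refl) with ≤-total s t
  ... | inj₁ s≤t = segment-walk-up hi≤ lo≤s s≤t t<hi
  ... | inj₂ t≤s = WalkIn-reverse (segment-walk-up hi≤ lo≤t t≤s s<hi)

  segments-disjoint : ∀ {lo hi lo′ hi′ x} → hi ≤ lo′ → hi′ ≤ suc L →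
                      InSegment lo hi x → InSegment lo′ hi′ x → ⊥
  segments-disjoint hi≤lo′ hi′≤ (s , _ , s<hi , refl) (t , lo′≤t , t<hi′ , eq) =
    <-irrefl (at-injective s≤L t≤L (sym eq)) (<-≤-trans s<hi (≤-trans hi≤lo′ lo′≤t))
    where
      t≤L = ≤-pred (≤-trans t<hi′ hi′≤)
      s≤L = ≤-trans (<⇒≤ (<-≤-trans s<hi (≤-trans hi≤lo′ lo′≤t))) t≤L

  interior≢start : ∀ {x} → Interior x → x ≢ a
  interior≢start (t , 1≤t , t<L , refl) eq =
    <-irrefl (at-injective z≤n (<⇒≤ t<L) (trans at-zero (sym eq))) 1≤t

  interior≢end : ∀ {x} → Interior x → x ≢ b
  interior≢end (t , _ , t<L , refl) eq =
    <-irrefl (at-injective (<⇒≤ t<L) ≤-refl (trans eq (sym at-len))) t<L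

  start-neighbour : 2 ≤ L → ∃ λ x → Interior x × E G a x
  start-neighbour 2≤L = at 1 , (1 , ≤-refl , 2≤L , refl) ,
    subst (λ y → E G y (at 1)) at-zero (at-adjacent (≤-trans (s≤s z≤n) 2≤L))

  end-neighbour : 2 ≤ L → ∃ λ x → Interior x × E G x b
  end-neighbour 2≤L with two≤⇒penultimate 2≤L
  ... | t , 1+t≡L , 1≤t = at t , (t , 1≤t , ≤-reflexive 1+t≡L , refl) ,
    subst (E G (at t)) (trans (cong at 1+t≡L) at-len) (at-adjacent (≤-reflexive 1+t≡L))

interior-avoids : ∀ {G} (S : K23Subdivision G) {k l : Fin 3} → k ≢ l →
                  ∀ {x} → Interior (path S k) x → ∀ s → at (path S l) s ≢ x
interior-avoids S {k} {l} k≢l x∈@(t , _ , _ , refl) s eq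
  with at-on-path (path S k) t | at-on-path (path S l) s
... | i , tᵢ | j , sⱼ with disjoint S k l k≢l i j (trans (sym tᵢ) (trans (sym eq) sⱼ))
... | inj₁ ≡u = interior≢start (path S k) x∈ (trans tᵢ ≡u)
... | inj₂ ≡v = interior≢end (path S k) x∈ (trans tᵢ ≡v)

other-two : (k : Fin 3) → ∃₂ λ l m → k ≢ l × k ≢ m × l ≢ m
other-two zero             = suc zero , suc (suc zero) , (λ ()) , (λ ()) , (λ ())
other-two (suc zero)       = zero , suc (suc zero) , (λ ()) , (λ ()) , (λ ())
other-two (suc (suc zero)) = zero , suc zero , (λ ()) , (λ ()) , (λ ())

pattern hub₀  = zero
pattern hub₁  = suc zero
pattern leaf₂ = suc (suc zero)
pattern leaf₃ = suc (suc (suc zero))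
pattern leaf₄ = suc (suc (suc (suc zero)))

module TerminalChord {G : Graph} (S : K23Subdivision G) {k l m : Fin 3}
  (k≢l : k ≢ l) (k≢m : k ≢ m) (l≢m : l ≢ m)
  {I J : ℕ} (I<J : I < J) (J<L : J < len (path S k))
  (chord : E G (at (path S k) I) (at (path S k) (suc J))) where

  private
    Pk = path S k
    Pl = path S l
    Pm = path S m
    L = len Pk

  branch : Fin 5 → Vtx G → Set
  branch hub₀  = InSegment Pk 0 (suc I)
  branch hub₁  = InSegment Pk (suc J) (suc L)
  branch leaf₂ = InSegment Pk (suc I) (suc J)
  branch leaf₃ = Interior Pl
  branch leaf₄ = Interior Pm

  branch? : ∀ h x → Dec (branch h x)
  branch? hub₀  = inSegment? Pk _ _
  branch? hub₁  = inSegment? Pk _ _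
  branch? leaf₂ = inSegment? Pk _ _
  branch? leaf₃ = inSegment? Pl _ _
  branch? leaf₄ = inSegment? Pm _ _

  I<1+L : suc I ≤ suc L
  I<1+L = ≤-trans (<⇒≤ (s≤s I<J)) (<⇒≤ (s≤s J<L))

  J<1+L : suc J ≤ suc L
  J<1+L = <⇒≤ (s≤s J<L)

  branch-connected : ∀ h {x y} → branch h x → branch h y → WalkIn G (branch h) x y
  branch-connected hub₀  = segment-connected Pk I<1+L
  branch-connected hub₁  = segment-connected Pk ≤-refl
  branch-connected leaf₂ = segment-connected Pk J<1+L
  branch-connected leaf₃ = segment-connected Pl (n≤1+n _)
  branch-connected leaf₄ = segment-connected Pm (n≤1+n _)

  interior-avoids-Pk : ∀ {p lo hi x} → p ≢ k → Interior (path S p) x → InSegment Pk lo hi x → ⊥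
  interior-avoids-Pk p≢k x∈ (s , _ , _ , eq) = interior-avoids S p≢k x∈ s eq

  branches-disjoint : ∀ {h h′ x} → branch h x → branch h′ x → h ≡ h′
  branches-disjoint {hub₀}  {hub₀}  _ _ = refl
  branches-disjoint {hub₀}  {hub₁}  b b′ = ⊥-elim (segments-disjoint Pk (s≤s (<⇒≤ I<J)) ≤-refl b b′)
  branches-disjoint {hub₀}  {leaf₂} b b′ = ⊥-elim (segments-disjoint Pk ≤-refl J<1+L b b′)
  branches-disjoint {hub₀}  {leaf₃} b b′ = ⊥-elim (interior-avoids-Pk (≢-sym k≢l) b′ b)
  branches-disjoint {hub₀}  {leaf₄} b b′ = ⊥-elim (interior-avoids-Pk (≢-sym k≢m) b′ b)
  branches-disjoint {hub₁}  {hub₀}  b b′ = ⊥-elim (segments-disjoint Pk (s≤s (<⇒≤ I<J)) ≤-refl b′ b)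
  branches-disjoint {hub₁}  {hub₁}  _ _ = refl
  branches-disjoint {hub₁}  {leaf₂} b b′ = ⊥-elim (segments-disjoint Pk ≤-refl ≤-refl b′ b)
  branches-disjoint {hub₁}  {leaf₃} b b′ = ⊥-elim (interior-avoids-Pk (≢-sym k≢l) b′ b)
  branches-disjoint {hub₁}  {leaf₄} b b′ = ⊥-elim (interior-avoids-Pk (≢-sym k≢m) b′ b)
  branches-disjoint {leaf₂} {hub₀}  b b′ = ⊥-elim (segments-disjoint Pk ≤-refl J<1+L b′ b)
  branches-disjoint {leaf₂} {hub₁}  b b′ = ⊥-elim (segments-disjoint Pk ≤-refl ≤-refl b b′)
  branches-disjoint {leaf₂} {leaf₂} _ _ = refl
  branches-disjoint {leaf₂} {leaf₃} b b′ = ⊥-elim (interior-avoids-Pk (≢-sym k≢l) b′ b)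
  branches-disjoint {leaf₂} {leaf₄} b b′ = ⊥-elim (interior-avoids-Pk (≢-sym k≢m) b′ b)
  branches-disjoint {leaf₃} {hub₀}  b b′ = ⊥-elim (interior-avoids-Pk (≢-sym k≢l) b b′)
  branches-disjoint {leaf₃} {hub₁}  b b′ = ⊥-elim (interior-avoids-Pk (≢-sym k≢l) b b′)
  branches-disjoint {leaf₃} {leaf₂} b b′ = ⊥-elim (interior-avoids-Pk (≢-sym k≢l) b b′)
  branches-disjoint {leaf₃} {leaf₃} _ _ = refl
  branches-disjoint {leaf₃} {leaf₄} b (s , _ , _ , eq) = ⊥-elim (interior-avoids S l≢m b s eq)
  branches-disjoint {leaf₄} {hub₀}  b b′ = ⊥-elim (interior-avoids-Pk (≢-sym k≢m) b b′)
  branches-disjoint {leaf₄} {hub₁}  b b′ = ⊥-elim (interior-avoids-Pk (≢-sym k≢m) b b′)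
  branches-disjoint {leaf₄} {leaf₂} b b′ = ⊥-elim (interior-avoids-Pk (≢-sym k≢m) b b′)
  branches-disjoint {leaf₄} {leaf₃} b (s , _ , _ , eq) = ⊥-elim (interior-avoids S (≢-sym l≢m) b s eq)
  branches-disjoint {leaf₄} {leaf₄} _ _ = refl

  u∈hub₀ : branch hub₀ (u S)
  u∈hub₀ = 0 , z≤n , s≤s z≤n , at-zero Pk

  v∈hub₁ : branch hub₁ (v S)
  v∈hub₁ = L , J<L , ≤-refl , at-len Pk

  branch-nonempty : ∀ h → ∃ (branch h)
  branch-nonempty hub₀  = u S , u∈hub₀
  branch-nonempty hub₁  = v S , v∈hub₁
  branch-nonempty leaf₂ = at Pk (suc I) , suc I , ≤-refl , s≤s I<J , refl
  branch-nonempty leaf₃ = let x , x∈ , _ = start-neighbour Pl (long S l) in x , x∈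
  branch-nonempty leaf₄ = let x , x∈ , _ = start-neighbour Pm (long S m) in x , x∈

  hub₀-hub₁ : Adjacent G (branch hub₀) (branch hub₁)
  hub₀-hub₁ = adjacent (I , z≤n , ≤-refl , refl) (suc J , ≤-refl , s≤s J<L , refl) chord

  hub₀-leaf₂ : Adjacent G (branch hub₀) (branch leaf₂)
  hub₀-leaf₂ = adjacent (I , z≤n , ≤-refl , refl) (suc I , ≤-refl , s≤s I<J , refl)
                        (at-adjacent Pk (≤-trans I<J (<⇒≤ J<L)))

  leaf₂-hub₁ : Adjacent G (branch leaf₂) (branch hub₁)
  leaf₂-hub₁ = adjacent (J , I<J , ≤-refl , refl) (suc J , ≤-refl , s≤s J<L , refl) (at-adjacent Pk J<L)

  hub₀-interior : ∀ p → Adjacent G (branch hub₀) (Interior (path S p))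
  hub₀-interior p = let _ , y∈ , e = start-neighbour (path S p) (long S p) in adjacent u∈hub₀ y∈ e

  interior-hub₁ : ∀ p → Adjacent G (Interior (path S p)) (branch hub₁)
  interior-hub₁ p = let _ , x∈ , e = end-neighbour (path S p) (long S p) in adjacent x∈ v∈hub₁ e

  branches-adjacent : ∀ h h′ → E K113 h h′ → Adjacent G (branch h) (branch h′)
  branches-adjacent hub₀  hub₁  _ = hub₀-hub₁
  branches-adjacent hub₀  leaf₂ _ = hub₀-leaf₂
  branches-adjacent hub₀  leaf₃ _ = hub₀-interior l
  branches-adjacent hub₀  leaf₄ _ = hub₀-interior m
  branches-adjacent hub₁  hub₀  _ = Adjacent-sym hub₀-hub₁
  branches-adjacent hub₁  leaf₂ _ = Adjacent-sym leaf₂-hub₁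
  branches-adjacent hub₁  leaf₃ _ = Adjacent-sym (interior-hub₁ l)
  branches-adjacent hub₁  leaf₄ _ = Adjacent-sym (interior-hub₁ m)
  branches-adjacent leaf₂ hub₀  _ = Adjacent-sym hub₀-leaf₂
  branches-adjacent leaf₂ hub₁  _ = leaf₂-hub₁
  branches-adjacent leaf₃ hub₀  _ = Adjacent-sym (hub₀-interior l)
  branches-adjacent leaf₃ hub₁  _ = interior-hub₁ l
  branches-adjacent leaf₄ hub₀  _ = Adjacent-sym (hub₀-interior m)
  branches-adjacent leaf₄ hub₁  _ = interior-hub₁ m
  branches-adjacent hub₀  hub₀  ()
  branches-adjacent hub₁  hub₁  ()
  branches-adjacent (suc (suc _)) (suc (suc _)) ()

  minor : HasMinor G K113
  minor = branchSets⇒minor record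
    { Branch = branch ; branch? = branch? ; branches-disjoint = branches-disjoint
    ; branch-nonempty = branch-nonempty ; branch-connected = branch-connected
    ; branches-adjacent = branches-adjacent }

terminal-chord⇒K113-minor : ∀ {G} (S : K23Subdivision G) (k : Fin 3) {I J : ℕ} →
  I < J → J < len (path S k) → E G (at (path S k) I) (at (path S k) (suc J)) → HasMinor G K113
terminal-chord⇒K113-minor S k I<J J<L chord =
  let l , m , k≢l , k≢m , l≢m = other-two k
  in TerminalChord.minor S k≢l k≢m l≢m I<J J<L chord

lemma1 : (G : Graph) → ¬ HasMinor G K113 → (S : K23Subdivision G) →
    Spanning S → (k : Fin 3) → Chordless (path S k)
lemma1 G noMinor S _ k i (suc j) (s≤s i<j) chord =
  noMinor (terminal-chord⇒K113-minor S k i<j (≤-pred (toℕ<n (suc j)))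
    (subst₂ (E G) (sym (at-index (path S k) i refl)) (sym (at-index (path S k) (suc j) refl)) chord))
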